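{- Let $m>1$, $k$ and $n$ be positive integers, and write $n$ in base $m$ as $n=\sum_{j\geqslant 0}c_jm^j$ with digits $c_j\in\{0,1,\ldots,m-1\}$ (with $c_j=0$ for all sufficiently large $j$). Let $\mathcal{M}=(m^{i-1})_{i\in\mathbb{N}_+}$. Then \[ p_\mathcal{M}(n,k)\equiv (c_1+1)(c_2+1)\cdots(c_{k-1}+1)\pmod{m} \] (the empty product being $1$ when $k=1$).
   Context: For a sequence $\mathcal{A}=(a_n)_{n\in\mathbb{N}_+}$ of positive integers, $k\in\mathbb{N}_+$ and $n\in\mathbb{N}$, $p_\mathcal{A}(n,k)$ is the number of tuples $(x_1,\ldots,x_k)\in\mathbb{N}^k$ with $a_1x_1+\cdots+a_kx_k=n$. Thus $p_\mathcal{M}(n,k)$ is the number of representations of $n$ as a sum of the powers $1,m,\ldots,m^{k-1}$ (restricted $m$-ary partitions), with $\sum_{n\ge0}p_\mathcal{M}(n,k)x^n=\prod_{i=0}^{k-1}(1-x^{m^i})^{ -1}$. -}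

module Defs where

open import Data.Nat using (ℕ; zero; suc; _+_; _*_; _∸_; _^_; _≤ᵇ_; _≡ᵇ_; NonZero)
open import Data.Nat.DivMod using (_/_; _%_)
open import Data.Bool using (if_then_else_)
open import Data.Nat.Properties using (m^n≢0)
open import Data.List using (List; map; upTo; filterᵇ)
open import Data.Nat.ListAction using (sum; product)

-- A sequence 𝒜 = (a_i)_{i ∈ ℕ₊}, represented 1-indexed: a i is a_i for i ≥ 1
-- (the value at 0 is irrelevant).
Seq : Set
Seq = ℕ → ℕ

-- p 𝒜 n k = #{ (x_1,…,x_k) ∈ ℕ^k : a_1 x_1 + ⋯ + a_k x_k = n },
-- counted by splitting on the value of the last coordinate x_k.
-- For positive a_k, the admissible x_k are those with a_k * x_k ≤ n, all of which lie
-- in upTo (suc n) = [0 … n].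
-- k = 0: only the empty tuple, whose sum is 0.
p : Seq → ℕ → ℕ → ℕ
p 𝒜 n zero = if n ≡ᵇ 0 then 1 else 0
p 𝒜 n (suc k) =
  sum (map (λ x → p 𝒜 (n ∸ 𝒜 (suc k) * x) k)
           (filterᵇ (λ x → 𝒜 (suc k) * x ≤ᵇ n) (upTo (suc n))))

𝓜 : ℕ → Seq
𝓜 m i = m ^ (i ∸ 1)

digit : (m : ℕ) → .{{NonZero m}} → ℕ → ℕ → ℕ
digit m n j = (n / (m ^ j)) % m
  where instance _ = m^n≢0 m j

digitProd : (m : ℕ) → .{{NonZero m}} → ℕ → ℕ → ℕ
digitProd m n k = product (map (λ j → suc (digit m n (suc j))) (upTo (k ∸ 1)))

-- Splitting on the coefficient x of m^k gives p(n, k+1) = Σ_{x ≤ ⌊n/m^k⌋} p(n − m^k x, k).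
-- Subtracting a multiple of m^k leaves the digits c_1, …, c_{k−1} unchanged, so by induction
-- every summand is ≡ (c_1+1)⋯(c_{k−1}+1) mod m, and there are ⌊n/m^k⌋ + 1 ≡ c_k + 1 summands.
module Submission where

open import Defs
open import Data.Nat using (ℕ; zero; suc; _+_; _*_; _∸_; _^_; _<_; _≤_; _%_; _/_; _⊓_; _≤ᵇ_; NonZero; s≤s)
open import Data.Nat.Properties
open import Data.Nat.DivMod
open import Data.Nat.Divisibility using (divides)
open import Data.Bool using (T)
open import Data.List using (List; []; _∷_; _++_; [_]; map; upTo; applyUpTo; filter; filterᵇ; length)
open import Data.List.Properties using (upTo-∷ʳ; map-upTo; map-cong; map-++; map-cong-local; length-upTo; ++-identityʳ; filter-++; filter-accept; filter-reject; filter-≐)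
open import Data.List.Relation.Unary.All as All using (All; []; _∷_)
open import Data.List.Relation.Unary.All.Properties using (all-upTo)
open import Data.Nat.ListAction using (sum; product)
open import Data.Nat.ListAction.Properties using (product-++)
open import Data.Nat.Tactic.RingSolver using (solve-∀)
open import Data.Product using (_,_)
open import Function using (_∘_)
open import Relation.Nullary using (Dec; yes; no)
open import Relation.Nullary.Decidable using (T?)
open import Relation.Binary.PropositionalEquality using (_≡_; refl; sym; trans; cong; cong₂; subst; module ≡-Reasoning)
open ≡-Reasoning

filter-<-upTo : ∀ t N → filter (_<? t) (upTo N) ≡ upTo (N ⊓ t)
filter-<-upTo t zero = refl
filter-<-upTo t (suc N) = begin
  filter (_<? t) (upTo (suc N))                   ≡⟨ cong (filter (_<? t)) (sym (upTo-∷ʳ N)) ⟩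
  filter (_<? t) (upTo N ++ [ N ])                ≡⟨ filter-++ (_<? t) (upTo N) [ N ] ⟩
  filter (_<? t) (upTo N) ++ filter (_<? t) [ N ] ≡⟨ cong (_++ filter (_<? t) [ N ]) (filter-<-upTo t N) ⟩
  upTo (N ⊓ t) ++ filter (_<? t) [ N ]            ≡⟨ last-step ⟩
  upTo (suc N ⊓ t)                                ∎
  where
  last-step : upTo (N ⊓ t) ++ filter (_<? t) [ N ] ≡ upTo (suc N ⊓ t)
  last-step with N <? t
  ... | yes N<t
    rewrite filter-accept (_<? t) {xs = []} N<t | m≤n⇒m⊓n≡m (<⇒≤ N<t) | m≤n⇒m⊓n≡m N<t = upTo-∷ʳ N
  ... | no N≮t
    rewrite filter-reject (_<? t) {xs = []} N≮t | m≥n⇒m⊓n≡n (≮⇒≥ N≮t) | m≥n⇒m⊓n≡n (m≤n⇒m≤1+n (≮⇒≥ N≮t)) =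
    ++-identityʳ (upTo t)

sum-map-%-const : ∀ {c d} .{{_ : NonZero d}} (f : ℕ → ℕ) {xs : List ℕ} →
  All (λ x → f x % d ≡ c % d) xs → sum (map f xs) % d ≡ length xs * c % d
sum-map-%-const f [] = refl
sum-map-%-const {c} {d} f {x ∷ xs} (fx≡c ∷ fxs≡c) = begin
  (f x + sum (map f xs)) % d            ≡⟨ %-distribˡ-+ (f x) _ d ⟩
  (f x % d + sum (map f xs) % d) % d    ≡⟨ cong₂ (λ u v → (u + v) % d) fx≡c (sum-map-%-const f fxs≡c) ⟩
  (c % d + length xs * c % d) % d       ≡⟨ sym (%-distribˡ-+ c _ d) ⟩
  (c + length xs * c) % d               ∎

*-congʳ-% : ∀ {a b} c d .{{_ : NonZero d}} → a % d ≡ b % d → a * c % d ≡ b * c % d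
*-congʳ-% {a} {b} c d a≡b = begin
  a * c % d                 ≡⟨ %-distribˡ-* a c d ⟩
  (a % d) * (c % d) % d     ≡⟨ cong (λ u → u * (c % d) % d) a≡b ⟩
  (b % d) * (c % d) % d     ≡⟨ sym (%-distribˡ-* b c d) ⟩
  b * c % d                 ∎

[1+m%n]%n≡[1+m]%n : ∀ m n .{{_ : NonZero n}} → suc (m % n) % n ≡ suc m % n
[1+m%n]%n≡[1+m]%n m n = begin
  suc (m % n) % n                 ≡⟨ sym ([m+kn]%n≡m%n (suc (m % n)) (m / n) n) ⟩
  (suc (m % n) + m / n * n) % n   ≡⟨ cong (λ z → suc z % n) (sym (m≡m%n+[m/n]*n m n)) ⟩
  suc m % n                       ∎

module _ (a n : ℕ) .{{_ : NonZero a}} where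

  a*x≤n⇒x≤n/a : ∀ {x} → a * x ≤ n → x ≤ n / a
  a*x≤n⇒x≤n/a {x} ax≤n = subst (_≤ n / a) (trans (cong (_/ a) (*-comm a x)) (m*n/n≡m x a)) (/-monoˡ-≤ a ax≤n)

  x≤n/a⇒a*x≤n : ∀ {x} → x ≤ n / a → a * x ≤ n
  x≤n/a⇒a*x≤n x≤n/a = ≤-trans (*-monoʳ-≤ a x≤n/a) (subst (_≤ n) (*-comm (n / a) a) (m/n*n≤m n a))

p-suc : (𝒜 : Seq) (n k : ℕ) .{{_ : NonZero (𝒜 (suc k))}} →
  p 𝒜 n (suc k) ≡ sum (map (λ x → p 𝒜 (n ∸ 𝒜 (suc k) * x) k) (upTo (suc (n / 𝒜 (suc k)))))
p-suc 𝒜 n k = cong (λ xs → sum (map (λ x → p 𝒜 (n ∸ a * x) k) xs)) (begin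
  filterᵇ (λ x → a * x ≤ᵇ n) (upTo (suc n))  ≡⟨ filter-≐ admissible? (_<? suc q) (admissible⇒< , <⇒admissible) (upTo (suc n)) ⟩
  filter (_<? suc q) (upTo (suc n))          ≡⟨ filter-<-upTo (suc q) (suc n) ⟩
  upTo (suc n ⊓ suc q)                       ≡⟨ cong upTo (m≥n⇒m⊓n≡n (s≤s (m/n≤m n a))) ⟩
  upTo (suc q)                               ∎)
  where
  a q : ℕ
  a = 𝒜 (suc k)
  q = n / a
  admissible? : ∀ x → Dec (T (a * x ≤ᵇ n))
  admissible? x = T? (a * x ≤ᵇ n)
  admissible⇒< : ∀ {x} → T (a * x ≤ᵇ n) → x < suc q
  admissible⇒< t = s≤s (a*x≤n⇒x≤n/a a n (≤ᵇ⇒≤ _ n t))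
  <⇒admissible : ∀ {x} → x < suc q → T (a * x ≤ᵇ n)
  <⇒admissible x<1+q = ≤⇒≤ᵇ (x≤n/a⇒a*x≤n a n (≤-pred x<1+q))

module _ (m : ℕ) .{{_ : NonZero m}} where

  digit-+-^* : ∀ {i j} r x → j < i → digit m (r + m ^ i * x) j ≡ digit m r j
  digit-+-^* {j = j} r x j<i with t , refl ← m≤n⇒∃[o]m+o≡n j<i = begin
    (r + m ^ (suc j + t) * x) / d % m   ≡⟨ cong (λ z → (r + z) / d % m) shift ⟩
    (r + B * m * d) / d % m             ≡⟨ cong (_% m) (+-distrib-/-∣ʳ r {d = d} (divides (B * m) refl)) ⟩
    (r / d + B * m * d / d) % m         ≡⟨ cong (λ z → (r / d + z) % m) (m*n/n≡m (B * m) d) ⟩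
    (r / d + B * m) % m                 ≡⟨ [m+kn]%n≡m%n (r / d) B m ⟩
    r / d % m                           ∎
    where
    d B : ℕ
    d = m ^ j
    B = m ^ t * x
    instance _ = m^n≢0 m j
    shift : m ^ (suc j + t) * x ≡ B * m * d
    shift = trans (cong (_* x) (^-distribˡ-+-* m (suc j) t)) (reorder m d (m ^ t) x)
      where
      reorder : ∀ u v w y → u * v * w * y ≡ w * y * u * v
      reorder = solve-∀

  digitProd-+-^* : ∀ k r x → digitProd m (r + m ^ k * x) k ≡ digitProd m r k
  digitProd-+-^* zero r x = refl
  digitProd-+-^* (suc k) r x =
    cong product (map-cong-local (All.map (λ j<k → cong suc (digit-+-^* r x (s≤s j<k))) (all-upTo k)))

  digitProd-suc : ∀ n k → digitProd m n (suc (suc k)) ≡ digitProd m n (suc k) * suc (digit m n (suc k))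
  digitProd-suc n k = begin
    product (map f (upTo (suc k)))             ≡⟨ cong (product ∘ map f) (sym (upTo-∷ʳ k)) ⟩
    product (map f (upTo k ++ [ k ]))          ≡⟨ cong product (map-++ f (upTo k) [ k ]) ⟩
    product (map f (upTo k) ++ [ f k ])        ≡⟨ product-++ (map f (upTo k)) [ f k ] ⟩
    product (map f (upTo k)) * (f k * 1)       ≡⟨ cong (product (map f (upTo k)) *_) (*-identityʳ (f k)) ⟩
    product (map f (upTo k)) * f k             ∎
    where
    f : ℕ → ℕ
    f j = suc (digit m n (suc j))

sum-p-∸-zero : (𝒜 : Seq) (n : ℕ) → sum (applyUpTo (λ x → p 𝒜 (n ∸ x) 0) (suc n)) ≡ 1
sum-p-∸-zero 𝒜 zero = refl
sum-p-∸-zero 𝒜 (suc n) = sum-p-∸-zero 𝒜 n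

p-𝓜-one : ∀ m n → p (𝓜 m) n 1 ≡ 1
p-𝓜-one m n = begin
  p (𝓜 m) n 1                                                  ≡⟨ p-suc (𝓜 m) n 0 ⟩
  sum (map (λ x → p (𝓜 m) (n ∸ 1 * x) 0) (upTo (suc (n / 1)))) ≡⟨ cong (λ N → sum (map (λ x → p (𝓜 m) (n ∸ 1 * x) 0) (upTo (suc N)))) (n/1≡n n) ⟩
  sum (map (λ x → p (𝓜 m) (n ∸ 1 * x) 0) (upTo (suc n)))       ≡⟨ cong sum (map-cong (λ x → cong (λ y → p (𝓜 m) (n ∸ y) 0) (*-identityˡ x)) (upTo (suc n))) ⟩
  sum (map (λ x → p (𝓜 m) (n ∸ x) 0) (upTo (suc n)))           ≡⟨ cong sum (map-upTo _ (suc n)) ⟩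
  sum (applyUpTo (λ x → p (𝓜 m) (n ∸ x) 0) (suc n))            ≡⟨ sum-p-∸-zero (𝓜 m) n ⟩
  1                                                            ∎

p-𝓜≡digitProd-mod : ∀ m .{{_ : NonZero m}} k n → p (𝓜 m) n (suc k) % m ≡ digitProd m n (suc k) % m
p-𝓜≡digitProd-mod m zero n = cong (_% m) (p-𝓜-one m n)
p-𝓜≡digitProd-mod m (suc k) n = begin
  p (𝓜 m) n (suc (suc k)) % m                    ≡⟨ cong (_% m) (p-suc (𝓜 m) n (suc k)) ⟩
  sum (map term (upTo (suc q))) % m              ≡⟨ sum-map-%-const term (All.map term≡D (all-upTo (suc q))) ⟩
  length (upTo (suc q)) * D % m                  ≡⟨ cong (λ N → N * D % m) (length-upTo (suc q)) ⟩
  suc q * D % m                                  ≡⟨ *-congʳ-% D m (sym ([1+m%n]%n≡[1+m]%n q m)) ⟩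
  suc (digit m n (suc k)) * D % m                ≡⟨ cong (_% m) (*-comm (suc (digit m n (suc k))) D) ⟩
  D * suc (digit m n (suc k)) % m                ≡⟨ cong (_% m) (sym (digitProd-suc m n k)) ⟩
  digitProd m n (suc (suc k)) % m                ∎
  where
  a q D : ℕ
  a = m ^ suc k
  instance _ = m^n≢0 m (suc k)
  q = n / a
  D = digitProd m n (suc k)
  term : ℕ → ℕ
  term x = p (𝓜 m) (n ∸ a * x) (suc k)
  term≡D : ∀ {x} → x < suc q → term x % m ≡ D % m
  term≡D {x} x<1+q = begin
    term x % m                                   ≡⟨ p-𝓜≡digitProd-mod m k (n ∸ a * x) ⟩
    digitProd m (n ∸ a * x) (suc k) % m          ≡⟨ cong (_% m) (sym (digitProd-+-^* m (suc k) (n ∸ a * x) x)) ⟩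
    digitProd m (n ∸ a * x + a * x) (suc k) % m  ≡⟨ cong (λ z → digitProd m z (suc k) % m) (m∸n+n≡m (x≤n/a⇒a*x≤n a n (≤-pred x<1+q))) ⟩
    D % m                                        ∎

theorem6p2 : (m k n : ℕ) → 1 < m → .{{_ : NonZero m}} → 1 ≤ k → 1 ≤ n →
    p (𝓜 m) n k % m ≡ digitProd m n k % m
theorem6p2 m (suc k) n _ _ _ = p-𝓜≡digitProd-mod m k n
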